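{- (Inductive soundness of S-resolution reductions.) Let $P$ be a logic program over a signature $\Sigma$ and let $t \in \mathbf{Term}(\Sigma)$. If $[t] \leadsto_{s,P}^n [\,]$ for some $n \in \mathbb{N}$ and this S-resolution reduction computes the answer $\theta$, then there exists a term $t' \in \mathbf{Term}(\Sigma)$ such that $t' \in M_P$ and $t'$ is an instance of $\theta(t)$.
   Context: Fix a signature $\Sigma$ of function symbols with arities, containing at least one symbol of arity $0$, and a countably infinite set of variables. $\mathbf{Term}(\Sigma)$ is the set of finite first-order terms over $\Sigma$ (with variables), $\mathbf{GTerm}(\Sigma)$ the set of finite ground (variable-free) terms. A clause is $A \gets B_0,\ldots,B_m$ with $A, B_j \in \mathbf{Term}(\Sigma)$ ($m\ge -1$, i.e. the body may be empty); a logic program $P$ is a finite list of clauses. A substitution $\sigma$ is a matcher of $s$ against $u$ if $\sigma(s)=u$, and a unifier of $s,u$ if $\sigma(s)=\sigma(u)$; mgm/mgu denote most general matcher/unifier. Clause variables are always renamed apart from those of the goal. The least Herbrand model $M_P$ is the smallest set of finite ground terms closed under the rule: if $A\gets B_1,\ldots,B_n$ is a clause of $P$, $\sigma$ is a grounding substitution, and $\sigma(B_1),\ldots,\sigma(B_n)\in M_P$, then $\sigma(A)\in M_P$. Reductions on finite lists of terms: a rewriting step $[t_1,\ldots,t_i,\ldots,t_n]\to_P[t_1,\ldots,t_{i-1},\sigma(B_0),\ldots,\sigma(B_m),t_{i+1},\ldots,t_n]$ if $A\gets B_0,\ldots,B_m$ is a clause of $P$ and $\sigma$ is an mgm of $A$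 against $t_i$ (i.e. $\sigma(A)=t_i$); a substitution step $[t_1,\ldots,t_n]\hookrightarrow_P[\sigma(t_1),\ldots,\sigma(t_n)]$ if some $t_i$ and the head $A$ of some clause of $P$ have mgu $\sigma$. $\to^\mu_P$ denotes reduction by $\to_P$ to a $\to_P$-normal form (a list to which no rewriting step applies). One S-resolution step $\leadsto_{s,P}$ is $\to^\mu_P$ followed by one $\hookrightarrow_P$ step, and $\leadsto_{s,P}^n$ is a sequence of $n$ such steps. The answer computed by such a reduction is the composition $\sigma_k\circ\cdots\circ\sigma_1$ of the substitutions $\sigma_1,\ldots,\sigma_k$ used in its steps, in order. -}

module Defs where

open import Data.Nat using (ℕ; zero; suc)
open import Data.Vec using (Vec; []; _∷_)
open import Data.List using (List; []; _∷_; _++_; [_])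
open import Data.List.Membership.Propositional using (_∈_)
open import Data.List.Relation.Unary.All using (All)
open import Data.List.Relation.Unary.Any using (Any)
open import Data.Product using (Σ; ∃; _×_; _,_)
open import Data.Empty using (⊥)
open import Data.Sum using (_⊎_)
open import Relation.Nullary using (¬_)
open import Relation.Binary.PropositionalEquality using (_≡_)
open import Relation.Binary.Construct.Closure.ReflexiveTransitive using (Star)
open import Function.Definitions using (Injective)

record Signature : Set₁ where
  field
    Sym      : Set
    arity    : Sym → ℕ
    constant : Σ Sym (λ c → arity c ≡ 0)

module Logic (Sig : Signature) where
  open Signature Sig

  Var : Set
  Var = ℕ

  data Term : Set where
    var : Var → Term
    fn  : (f : Sym) → Vec Term (arity f) → Term

  mutual
    data _occursIn_ (x : Var) : Term → Set where
      here : x occursIn var x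
      arg  : ∀ {f ts} → x occursInVec ts → x occursIn fn f ts

    data _occursInVec_ (x : Var) : ∀ {k} → Vec Term k → Set where
      hd : ∀ {k t} {ts : Vec Term k} → x occursIn t → x occursInVec (t ∷ ts)
      tl : ∀ {k t} {ts : Vec Term k} → x occursInVec ts → x occursInVec (t ∷ ts)

  _occursInList_ : Var → List Term → Set
  x occursInList ts = Any (x occursIn_) ts

  IsGround : Term → Set
  IsGround t = ∀ x → ¬ (x occursIn t)

  Subst : Set
  Subst = Var → Term

  mutual
    sub : Subst → Term → Term
    sub σ (var x)   = σ x
    sub σ (fn f ts) = fn f (subVec σ ts)

    subVec : ∀ {k} → Subst → Vec Term k → Vec Term k
    subVec σ []       = []
    subVec σ (t ∷ ts) = sub σ t ∷ subVec σ ts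

  subList : Subst → List Term → List Term
  subList σ []       = []
  subList σ (t ∷ ts) = sub σ t ∷ subList σ ts

  idₛ : Subst
  idₛ = var

  -- (σ ∘ₛ τ) = σ ∘ τ : first τ, then σ.
  _∘ₛ_ : Subst → Subst → Subst
  (σ ∘ₛ τ) x = sub σ (τ x)

  Grounding : Subst → Set
  Grounding σ = ∀ x → IsGround (σ x)

  Matcher : Subst → Term → Term → Set
  Matcher σ s u = sub σ s ≡ u

  MGM : Subst → Term → Term → Set
  MGM σ s u = Matcher σ s u ×
              (∀ τ → Matcher τ s u → ∃ λ ρ → ∀ x → τ x ≡ sub ρ (σ x))

  Unifier : Subst → Term → Term → Set
  Unifier σ s u = sub σ s ≡ sub σ u

  MGU : Subst → Term → Term → Set
  MGU σ s u = Unifier σ s u ×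
              (∀ τ → Unifier τ s u → ∃ λ ρ → ∀ x → τ x ≡ sub ρ (σ x))

  record Clause : Set where
    constructor _⇐_
    field
      head : Term
      body : List Term
  open Clause public

  Program : Set
  Program = List Clause

  renameClause : (ℕ → ℕ) → Clause → Clause
  renameClause r (A ⇐ Bs) = sub (λ x → var (r x)) A ⇐ subList (λ x → var (r x)) Bs

  _occursInClause_ : Var → Clause → Set
  x occursInClause C = (x occursIn head C) ⊎ (x occursInList body C)

  -- Least Herbrand model M_P (inductive, hence least).
  data _∈M_ : Term → Program → Set where
    rule : ∀ {P C σ} → C ∈ P → Grounding σ →
           All (λ B → sub σ B ∈M P) (body C) →
           sub σ (head C) ∈M P

  module _ (P : Program) where

    FreshVariant : Clause → List Term → Set
    FreshVariant C' L =
      (∃ λ C → C ∈ P × ∃ λ (r : ℕ → ℕ) → Injective _≡_ _≡_ r × C' ≡ renameClause r C)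
      × (∀ x → x occursInClause C' → ¬ (x occursInList L))

    data _⟶_ : List Term → List Term → Set where
      rw : ∀ pre t post C σ →
           FreshVariant C (pre ++ t ∷ post) →
           MGM σ (head C) t →
           (pre ++ t ∷ post) ⟶ (pre ++ subList σ (body C) ++ post)

    Normal : List Term → Set
    Normal L = ∀ L' → ¬ (L ⟶ L')

    _⟶μ_ : List Term → List Term → Set
    L ⟶μ L' = Star _⟶_ L L' × Normal L'

    data _↪[_]_ : List Term → Subst → List Term → Set where
      unif : ∀ pre t post C σ →
             FreshVariant C (pre ++ t ∷ post) →
             MGU σ t (head C) →
             (pre ++ t ∷ post) ↪[ σ ] subList σ (pre ++ t ∷ post)

    -- SRed n L θ : an S-resolution reduction  L ⇝ⁿ [ ]  with n substitution
    -- steps, computing the answer θ = σₙ ∘ ⋯ ∘ σ₁.  Each S-resolution step is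
    -- →^μ followed by one ↪ step; the reduction reaches [ ] in its final
    -- →^μ phase.
    data SRed : ℕ → List Term → Subst → Set where
      done : ∀ {L} → L ⟶μ [] → SRed 0 L idₛ
      step : ∀ {n L L₁ L₂ σ θ} → L ⟶μ L₁ → L₁ ↪[ σ ] L₂ →
             SRed n L₂ θ → SRed (suc n) L (θ ∘ₛ σ)

module Submission where

-- Call a grounding substitution ρ a *ground solution* of a goal list L when
-- every ρ-instance of a goal of L lies in the least Herbrand model M_P.
-- The proof rests on one invariant, established by induction on the
-- S-resolution reduction  L ⇝ⁿ [ ]  computing θ:
--
--     some grounding ρ makes  ρ ∘ θ  a ground solution of L.
--
-- Two facts drive the induction.  (1) Rewriting steps reflect ground
-- solutions: if L ⟶ L' by a clause variant and ρ solves L', then ρ solves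
-- L, because the rewritten goal is a ground instance of the clause head whose
-- body instances are solved (the variant is an instance of a clause of P).
-- (2) Ground solutions are stable under instantiation: if ρ solves σ(L)
-- then ρ ∘ σ solves L, and ρ ∘ σ is grounding whenever ρ is.  A substitution step
-- σ is absorbed by (2), the →^μ phases by (1), and the base case uses a
-- grounding substitution built from the constant of the signature.  The
-- theorem is the invariant for the one-element list [ t ].

open import Defs
open import Data.List using (List; [_]; []; _∷_; _++_)
open import Data.Nat using (ℕ)
open import Data.Vec using (Vec; []; _∷_)
open import Data.Product using (∃; _×_; _,_; proj₁; proj₂)
open import Data.List.Membership.Propositional using (_∈_)
open import Data.List.Relation.Unary.All using (All; []; _∷_)
import Data.List.Relation.Unary.All as All
open import Data.List.Relation.Unary.All.Properties using (++⁺; ++⁻)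
open import Relation.Nullary using (¬_)
open import Relation.Binary.PropositionalEquality
  using (_≡_; refl; sym; cong; cong₂; subst; module ≡-Reasoning)
open import Relation.Binary.Construct.Closure.ReflexiveTransitive using (Star; ε; _◅_)

module Soundness (Sig : Signature) where
  open Signature Sig
  open Logic Sig

  mutual
    sub-∘ : ∀ σ τ u → sub σ (sub τ u) ≡ sub (σ ∘ₛ τ) u
    sub-∘ σ τ (var x)   = refl
    sub-∘ σ τ (fn f ts) = cong (fn f) (subVec-∘ σ τ ts)

    subVec-∘ : ∀ σ τ {k} (ts : Vec Term k) → subVec σ (subVec τ ts) ≡ subVec (σ ∘ₛ τ) ts
    subVec-∘ σ τ []       = refl
    subVec-∘ σ τ (t ∷ ts) = cong₂ _∷_ (sub-∘ σ τ t) (subVec-∘ σ τ ts)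

  sub-∘-assoc : ∀ ρ θ σ u → sub ((ρ ∘ₛ θ) ∘ₛ σ) u ≡ sub (ρ ∘ₛ (θ ∘ₛ σ)) u
  sub-∘-assoc ρ θ σ u = begin
    sub ((ρ ∘ₛ θ) ∘ₛ σ) u    ≡⟨ sym (sub-∘ (ρ ∘ₛ θ) σ u) ⟩
    sub (ρ ∘ₛ θ) (sub σ u)   ≡⟨ sym (sub-∘ ρ θ (sub σ u)) ⟩
    sub ρ (sub θ (sub σ u))  ≡⟨ cong (sub ρ) (sub-∘ θ σ u) ⟩
    sub ρ (sub (θ ∘ₛ σ) u)   ≡⟨ sub-∘ ρ (θ ∘ₛ σ) u ⟩
    sub (ρ ∘ₛ (θ ∘ₛ σ)) u    ∎
    where open ≡-Reasoning

  mutual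
    sub-ground : ∀ {ρ} → Grounding ρ → ∀ u → IsGround (sub ρ u)
    sub-ground g (var y)   x p       = g y x p
    sub-ground g (fn f ts) x (arg p) = subVec-ground g ts x p

    subVec-ground : ∀ {ρ} → Grounding ρ → ∀ {k} (ts : Vec Term k) →
                    ∀ x → ¬ (x occursInVec subVec ρ ts)
    subVec-ground g (t ∷ ts) x (hd p) = sub-ground g t x p
    subVec-ground g (t ∷ ts) x (tl p) = subVec-ground g ts x p

  ∘-grounding : ∀ {ρ} → Grounding ρ → ∀ τ → Grounding (ρ ∘ₛ τ)
  ∘-grounding g τ x = sub-ground g (τ x)

  emptyVec-ground : ∀ {k} (ts : Vec Term k) → k ≡ 0 → ∀ x → ¬ (x occursInVec ts)
  emptyVec-ground []      _  x ()
  emptyVec-ground (_ ∷ _) ()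

  groundConstant : Term
  groundConstant = fn (proj₁ constant) (subst (Vec Term) (sym (proj₂ constant)) [])

  groundConstant-ground : IsGround groundConstant
  groundConstant-ground x (arg p) =
    emptyVec-ground (subst (Vec Term) (sym (proj₂ constant)) []) (proj₂ constant) x p

  someGrounding : ∃ Grounding
  someGrounding = (λ _ → groundConstant) , (λ _ → groundConstant-ground)

  All-subList⁻ : ∀ {Q : Term → Set} σ L → All Q (subList σ L) → All (λ u → Q (sub σ u)) L
  All-subList⁻ σ []      []       = []
  All-subList⁻ σ (u ∷ L) (p ∷ ps) = p ∷ All-subList⁻ σ L ps

  module _ (P : Program) where

    Solves : Subst → List Term → Set
    Solves ρ L = All (λ u → sub ρ u ∈M P) L

    Solves-cong : ∀ {ρ ρ'} → (∀ u → sub ρ u ≡ sub ρ' u) → ∀ {L} → Solves ρ L → Solves ρ' L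
    Solves-cong eq = All.map (λ {u} → subst (_∈M P) (eq u))

    Solves-instance : ∀ ρ σ L → Solves ρ (subList σ L) → Solves (ρ ∘ₛ σ) L
    Solves-instance ρ σ L s = All.map (λ {u} → subst (_∈M P) (sub-∘ ρ σ u)) (All-subList⁻ σ L s)

    -- The rule of M_P also applies to renamed variants of clauses of P:
    -- an instance of the variant is an instance of the original clause.
    variant-rule : ∀ {C} → C ∈ P → ∀ r γ → Grounding γ →
                   Solves γ (body (renameClause r C)) → sub γ (head (renameClause r C)) ∈M P
    variant-rule {A ⇐ Bs} C∈P r γ g s =
      subst (_∈M P) (sym (sub-∘ γ ren A))
        (rule C∈P (∘-grounding g ren)
          (Solves-instance γ ren Bs s))
      where
        ren : Subst
        ren x = var (r x)

    -- (1) A rewriting step reflects ground solutions: the rewritten goal t is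
    -- the ground instance ρ(σ(A)) of the variant's head, whose body is solved.
    ⟶-reflects : ∀ {L L'} ρ → Grounding ρ → _⟶_ P L L' → Solves ρ L' → Solves ρ L
    ⟶-reflects ρ g (rw pre t post C σ ((C₀ , C₀∈P , r , _ , refl) , _) (σA≡t , _)) s
      with ++⁻ pre s
    ... | s-pre , s-rest with ++⁻ (subList σ (body C)) s-rest
    ... | s-body , s-post = ++⁺ s-pre (t-solved ∷ s-post)
      where
        t-as-instance : sub (ρ ∘ₛ σ) (head C) ≡ sub ρ t
        t-as-instance = begin
          sub (ρ ∘ₛ σ) (head C)  ≡⟨ sym (sub-∘ ρ σ (head C)) ⟩
          sub ρ (sub σ (head C)) ≡⟨ cong (sub ρ) σA≡t ⟩
          sub ρ t                ∎
          where open ≡-Reasoning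

        t-solved : sub ρ t ∈M P
        t-solved = subst (_∈M P) t-as-instance
          (variant-rule C₀∈P r (ρ ∘ₛ σ) (∘-grounding g σ)
            (Solves-instance ρ σ (body C) s-body))

    ⟶*-reflects : ∀ {L L'} ρ → Grounding ρ → Star (_⟶_ P) L L' → Solves ρ L' → Solves ρ L
    ⟶*-reflects ρ g ε        s = s
    ⟶*-reflects ρ g (x ◅ xs) s = ⟶-reflects ρ g x (⟶*-reflects ρ g xs s)

    SRed-sound : ∀ {n L θ} → SRed P n L θ → ∃ λ ρ → Grounding ρ × Solves (ρ ∘ₛ θ) L
    SRed-sound (done (L⟶*[] , _)) with someGrounding
    ... | ρ , g = ρ , g , ⟶*-reflects ρ g L⟶*[] []
    SRed-sound (step {L₁ = L₁} {σ = σ} {θ = θ} (L⟶*L₁ , _) (unif _ _ _ _ _ _ _) rest)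
      with SRed-sound rest
    ... | ρ , g , s =
      ρ , g , Solves-cong (sub-∘-assoc ρ θ σ)
                (⟶*-reflects ((ρ ∘ₛ θ) ∘ₛ σ) (∘-grounding (∘-grounding g θ) σ) L⟶*L₁
                  (Solves-instance (ρ ∘ₛ θ) σ L₁ s))

open Logic

theorem2p13 : (Sig : Signature) (P : Program Sig) (t : Term Sig) (n : ℕ) (θ : Subst Sig) →
    SRed Sig P n [ t ] θ →
    ∃ λ (t' : Term Sig) → _∈M_ Sig t' P × ∃ λ (τ : Subst Sig) → sub Sig τ (sub Sig θ t) ≡ t'
theorem2p13 Sig P t n θ r with Soundness.SRed-sound Sig P r
... | ρ , _ , (ρθt∈M ∷ []) = sub Sig ρ (sub Sig θ t) , ρθt∈M' , ρ , refl
  where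
    ρθt∈M' : _∈M_ Sig (sub Sig ρ (sub Sig θ t)) P
    ρθt∈M' = subst (λ u → _∈M_ Sig u P) (sym (Soundness.sub-∘ Sig ρ θ t)) ρθt∈M
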